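{- Let $F(X,Y)$ be a CNF formula over the disjoint variable sets $X$ and $Y$, and let $X'\subseteq X$. Then $\exists X.\,F(X,Y)\equiv \exists (X\setminus X').\,\mathit{Dis}(F,X')$ if and only if the variables of $X'$ are redundant in $F$.
   Context: A point is a complete assignment to $X\cup Y$. For $Z'\subseteq X\cup Y$, a clause is a $Z'$-clause if it contains a variable of $Z'$, and a non-$Z'$-clause otherwise. $\mathit{Dis}(F,X')$ denotes the CNF formula obtained from $F$ by discarding all $X'$-clauses. A point $\boldsymbol{p}$ is a $Z'$-boundary point of $F$ if $F(\boldsymbol{p})=0$, every clause of $F$ falsified by $\boldsymbol{p}$ is a $Z'$-clause, and this property fails for every proper subset of $Z'$. A point $\boldsymbol{p}$ is a $Z'$-removable boundary point of $F$ if it is a $Z''$-boundary point for some $Z''\subseteq Z'$ and there is a clause $C$ falsified by $\boldsymbol{p}$ that is a non-$Z'$-clause and is implied by the conjunction of the $Z'$-clauses of $F$. The variables of $X'\subseteq X$ are redundant in $F$ if there is no point that is an $X''$-boundary point of $F$ for some $X''\subseteq X'$ and is also an $X$-removable boundary point of $F$. -}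

module Defs where

open import Data.Nat using (ℕ)
open import Data.Bool using (Bool)
open import Data.Fin using (Fin)
open import Data.Fin.Subset using (Subset; _∈_; _∉_; _⊆_; _⊂_; _─_)
open import Data.Fin.Subset.Properties using (_∈?_)
open import Data.List using (List; filter)
open import Data.List.Relation.Unary.All using (All)
open import Data.List.Relation.Unary.Any using (Any; any?)
open import Data.List.Membership.Propositional using () renaming (_∈_ to _∈ₗ_)
open import Data.Product using (Σ; ∃; _×_; proj₁; proj₂)
open import Relation.Binary.PropositionalEquality using (_≡_)
open import Relation.Nullary using (¬_; ¬?)
open import Relation.Nullary.Negation using ()
open import Function.Bundles using (_⇔_)

-- Variables are Fin n (the set X ∪ Y); X is a subset, Y its complement.
-- A point is a complete assignment to all n variables.
Point : ℕ → Set
Point n = Fin n → Bool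

-- A literal: a variable together with the polarity it requires
-- (v , true) is v, (v , false) is ¬v.
record Literal (n : ℕ) : Set where
  constructor lit
  field
    var : Fin n
    pol : Bool
open Literal public

Clause : ℕ → Set
Clause n = List (Literal n)

CNF : ℕ → Set
CNF n = List (Clause n)

module _ {n : ℕ} where

  LitTrue : Point n → Literal n → Set
  LitTrue p l = p (var l) ≡ pol l

  ClauseTrue : Point n → Clause n → Set
  ClauseTrue p C = Any (LitTrue p) C

  Falsifies : Point n → Clause n → Set
  Falsifies p C = ¬ ClauseTrue p C

  CNFTrue : Point n → CNF n → Set
  CNFTrue p F = All (ClauseTrue p) F

  IsClauseOf : Subset n → Clause n → Set
  IsClauseOf Z C = Any (λ l → var l ∈ Z) C

  isClauseOf? : (Z : Subset n) (C : Clause n) → Relation.Nullary.Dec (IsClauseOf Z C)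
  isClauseOf? Z C = any? (λ l → var l ∈? Z) C

  Dis : CNF n → Subset n → CNF n
  Dis F X' = filter (λ C → ¬? (isClauseOf? X' C)) F

  ClausesOf : CNF n → Subset n → CNF n
  ClausesOf F Z = filter (isClauseOf? Z) F

  FalsifiedAreClausesOf : CNF n → Point n → Subset n → Set
  FalsifiedAreClausesOf F p Z = ∀ C → C ∈ₗ F → Falsifies p C → IsClauseOf Z C

  IsBoundary : CNF n → Subset n → Point n → Set
  IsBoundary F Z p =
    ¬ CNFTrue p F
    × FalsifiedAreClausesOf F p Z
    × (∀ Z'' → Z'' ⊂ Z → ¬ FalsifiedAreClausesOf F p Z'')

  Implies : CNF n → Clause n → Set
  Implies G C = ∀ (q : Point n) → CNFTrue q G → ClauseTrue q C

  IsRemovableBoundary : CNF n → Subset n → Point n → Set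
  IsRemovableBoundary F Z p =
    (∃ λ Z'' → Z'' ⊆ Z × IsBoundary F Z'' p)
    × (∃ λ (C : Clause n) → Falsifies p C × ¬ IsClauseOf Z C × Implies (ClausesOf F Z) C)

  Redundant : CNF n → Subset n → Subset n → Set
  Redundant F X X' =
    ¬ (∃ λ (p : Point n) →
         (∃ λ X'' → X'' ⊆ X' × IsBoundary F X'' p) × IsRemovableBoundary F X p)

  ExistsSem : Subset n → CNF n → Point n → Set
  ExistsSem V G q = ∃ λ (p : Point n) → (∀ v → v ∉ V → p v ≡ q v) × CNFTrue p G

  Equiv : (Point n → Set) → (Point n → Set) → Set
  Equiv A B = ∀ q → A q ⇔ B q

-- (⇒) Let p be an X''-boundary point (X'' ⊆ X') that is X-removable through a
--     clause C.  Every clause p falsifies contains a variable of X', so p satisfies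
--     Dis(F, X'); the equivalence then yields a model p* of F agreeing with p
--     outside X.  But p* satisfies the X-clauses of F, hence C, and C mentions no
--     X-variable, so p satisfies C too: contradiction.
-- (⇐) ∃X. F ⇒ ∃(X ∖ X'). Dis(F, X') holds for every X' (reset the X'-part of a
--     model of F to the given point).  For the converse take p ⊨ Dis(F, X').  If no
--     point agreeing with p outside X satisfies F (decidable: there are finitely many
--     points), then p falsifies F only in X'-clauses, so it is a Z-boundary point for
--     a minimal Z ⊆ X', and the clause "the Y-part differs from that of p" is implied
--     by the X-clauses of F, making p X-removable; this contradicts redundancy.
module Submission where

open import Defs
open import Data.Nat using (ℕ)
open import Data.Nat.Induction using (<-wellFounded)
open import Data.Bool using (not)
import Data.Bool as Bool
open import Data.Bool.Properties using (not-¬; ¬-not)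
import Data.Fin.Properties as Fin
open import Data.Fin.Subset using (Subset; _⊆_; _─_; _⊂_; _∉_; ∣_∣)
open import Data.Fin.Subset.Properties
  using (_∈?_; _⊂?_; ∉⊥; ⊆-refl; ⊆-trans; p⊂q⇒p⊆q; p⊂q⇒∣p∣<∣q∣; p─q⊆p; x∈p∧x∉q⇒x∈p─q; anySubset?)
open import Data.List using (List; _∷_; map; filter; allFin)
open import Data.List.Relation.Unary.All using (All)
import Data.List.Relation.Unary.All as All
open import Data.List.Relation.Unary.All.Properties using (filter⁺)
import Data.List.Relation.Unary.Any as Any
open import Data.List.Relation.Unary.Any.Properties using (map⁻)
open import Data.List.Membership.Propositional using (find; lose) renaming (_∈_ to _∈ₗ_)
open import Data.List.Membership.Propositional.Properties using (∈-filter⁺; ∈-filter⁻; ∈-map⁺; ∈-allFin)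
open import Data.Vec using (lookup; tabulate)
open import Data.Vec.Properties using (lookup∘tabulate)
open import Data.Product using (∃; _×_; _,_; proj₂)
open import Data.Empty using (⊥-elim)
open import Function using (_∘_)
open import Level using (0ℓ)
open import Function.Bundles using (_⇔_; mk⇔; Equivalence)
open import Induction.WellFounded using (Acc; acc)
open import Relation.Binary.PropositionalEquality using (_≡_; _≗_; refl; sym; trans)
open import Relation.Nullary using (¬_; Dec; yes; no; ¬?; contradiction)
open import Relation.Nullary.Decidable using (_×-dec_; _→-dec_; map′; decidable-stable)
open import Relation.Unary using (Pred; Decidable)

module _ {A : Set} {P Q : Pred A 0ℓ} (P? : Decidable P) {xs : List A} where

  All-filter-lookup : All Q (filter P? xs) → ∀ {x} → x ∈ₗ xs → P x → Q x
  All-filter-lookup all x∈xs Px = All.lookup all (∈-filter⁺ P? x∈xs Px)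

  All-filter-tabulate : (∀ {x} → x ∈ₗ xs → P x → Q x) → All Q (filter P? xs)
  All-filter-tabulate f = All.tabulate (λ x∈ → let x∈xs , Px = ∈-filter⁻ P? {xs = xs} x∈ in f x∈xs Px)

-- Finitely many points: existence of a point with a decidable property invariant
-- under pointwise equality is decidable (points are enumerated as bit vectors).
anyPoint? : ∀ {n} {P : Point n → Set} → (∀ {r s} → r ≗ s → P r → P s) →
            (∀ r → Dec (P r)) → Dec (∃ P)
anyPoint? resp P? = map′ (λ (s , Ps) → lookup s , Ps)
                         (λ (r , Pr) → tabulate r , resp (sym ∘ lookup∘tabulate r) Pr)
                         (anySubset? (P? ∘ lookup))

module _ {n : ℕ} where

  AgreeOutside : Subset n → Point n → Point n → Set
  AgreeOutside Z p q = ∀ v → v ∉ Z → p v ≡ q v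

  clauseTrue? : (p : Point n) (C : Clause n) → Dec (ClauseTrue p C)
  clauseTrue? p = Any.any? (λ l → p (var l) Bool.≟ pol l)

  cnfTrue? : (p : Point n) (G : CNF n) → Dec (CNFTrue p G)
  cnfTrue? p = All.all? (clauseTrue? p)

  clause-agree : ∀ {Z r s} (C : Clause n) → ¬ IsClauseOf Z C → AgreeOutside Z r s →
                 ClauseTrue r C → ClauseTrue s C
  clause-agree (l ∷ C) noZ r≈s (Any.here t) =
    Any.here (trans (sym (r≈s (var l) (noZ ∘ Any.here))) t)
  clause-agree (l ∷ C) noZ r≈s (Any.there t) =
    Any.there (clause-agree C (noZ ∘ Any.there) r≈s t)

  -- Satisfaction of a CNF is invariant under pointwise equality (no clause meets ⊥).
  cnf-resp : ∀ {r s} (G : CNF n) → r ≗ s → CNFTrue r G → CNFTrue s G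
  cnf-resp G r≗s = All.map (λ {C} → clause-agree C (∉⊥ ∘ proj₂ ∘ Any.satisfied) (λ v _ → r≗s v))

  existsSem? : (V : Subset n) (G : CNF n) (q : Point n) → Dec (ExistsSem V G q)
  existsSem? V G q = anyPoint? resp (λ r → agree? r ×-dec cnfTrue? r G)
    where
    agree? : ∀ r → Dec (AgreeOutside V r q)
    agree? r = Fin.all? (λ v → ¬? (v ∈? V) →-dec (r v Bool.≟ q v))
    resp : ∀ {r s} → r ≗ s → AgreeOutside V r q × CNFTrue r G → AgreeOutside V s q × CNFTrue s G
    resp r≗s (r≈q , Gr) = (λ v v∉V → trans (sym (r≗s v)) (r≈q v v∉V)) , cnf-resp G r≗s Gr

  Dis-true⇔ : ∀ (F : CNF n) Z p → CNFTrue p (Dis F Z) ⇔ FalsifiedAreClausesOf F p Z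
  Dis-true⇔ F Z p = mk⇔ falsified⊆Z satisfies-Dis
    where
    falsified⊆Z : CNFTrue p (Dis F Z) → FalsifiedAreClausesOf F p Z
    falsified⊆Z Dp C C∈F ¬pC with isClauseOf? Z C
    ... | yes isZ = isZ
    ... | no notZ = contradiction (All-filter-lookup (¬? ∘ isClauseOf? Z) Dp C∈F notZ) ¬pC
    satisfies-Dis : FalsifiedAreClausesOf F p Z → CNFTrue p (Dis F Z)
    satisfies-Dis onlyZ = All-filter-tabulate (¬? ∘ isClauseOf? Z) λ {C} C∈F notZ →
      decidable-stable (clauseTrue? p C) (notZ ∘ onlyZ C C∈F)

  falsified-mono : ∀ {F : CNF n} {p Z Z'} → Z ⊆ Z' →
                   FalsifiedAreClausesOf F p Z → FalsifiedAreClausesOf F p Z'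
  falsified-mono Z⊆Z' onlyZ C C∈F ¬pC = Any.map Z⊆Z' (onlyZ C C∈F ¬pC)

  falsified? : ∀ (F : CNF n) p Z → Dec (FalsifiedAreClausesOf F p Z)
  falsified? F p Z = map′ (λ all C → All.lookup all) (λ onlyZ → All.tabulate (onlyZ _))
    (All.all? (λ C → ¬? (clauseTrue? p C) →-dec isClauseOf? Z C) F)

  minimal : ∀ {P : Pred (Subset n) 0ℓ} → Decidable P → ∀ {Z} → P Z →
            ∃ λ Z' → Z' ⊆ Z × P Z' × (∀ Z'' → Z'' ⊂ Z' → ¬ P Z'')
  minimal {P} P? {Z} PZ = go Z (<-wellFounded ∣ Z ∣) PZ
    where
    go : ∀ Z → Acc _ ∣ Z ∣ → P Z → ∃ λ Z' → Z' ⊆ Z × P Z' × (∀ Z'' → Z'' ⊂ Z' → ¬ P Z'')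
    go Z (acc smaller) PZ with anySubset? (λ Z'' → Z'' ⊂? Z ×-dec P? Z'')
    ... | no none = Z , ⊆-refl , PZ , λ Z'' Z''⊂Z PZ'' → none (Z'' , Z''⊂Z , PZ'')
    ... | yes (Z'' , Z''⊂Z , PZ'') =
      let Z' , Z'⊆Z'' , rest = go Z'' (smaller (p⊂q⇒∣p∣<∣q∣ Z''⊂Z)) PZ''
      in  Z' , ⊆-trans Z'⊆Z'' (p⊂q⇒p⊆q Z''⊂Z) , rest

  boundary-within : ∀ {F : CNF n} {p Z} → ¬ CNFTrue p F → FalsifiedAreClausesOf F p Z →
                    ∃ λ Z' → Z' ⊆ Z × IsBoundary F Z' p
  boundary-within {F} {p} unsat onlyZ =
    let Z' , Z'⊆Z , onlyZ' , minimalZ' = minimal (falsified? F p) onlyZ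
    in  Z' , Z'⊆Z , unsat , onlyZ' , minimalZ'

  RemovalClause : CNF n → Subset n → Point n → Clause n → Set
  RemovalClause F Z p C = Falsifies p C × ¬ IsClauseOf Z C × Implies (ClausesOf F Z) C

  extendable⇒no-removal-clause : ∀ {F : CNF n} {X p p* C} → CNFTrue p* F →
                                 AgreeOutside X p* p → ¬ RemovalClause F X p C
  extendable⇒no-removal-clause {F} {X} {C = C} Fp* p*≈p (¬pC , noX , implied) =
    ¬pC (clause-agree C noX p*≈p (implied _ (filter⁺ (isClauseOf? X) Fp*)))

  -- The blocking clause of p: the disjunction of the literals on variables outside X
  -- that p falsifies.  It is falsified exactly by the points agreeing with p outside X.
  blockingClause : Subset n → Point n → Clause n
  blockingClause X p = map (λ y → lit y (not (p y))) (filter (λ y → ¬? (y ∈? X)) (allFin n))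

  blocking-falsified : ∀ X p → Falsifies p (blockingClause X p)
  blocking-falsified X p t = not-¬ refl (proj₂ (Any.satisfied (map⁻ t)))

  blocking-avoids : ∀ X p → ¬ IsClauseOf X (blockingClause X p)
  blocking-avoids X p isX =
    let y , y∈kept , y∈X = find (map⁻ isX)
    in  proj₂ (∈-filter⁻ (λ y → ¬? (y ∈? X)) {xs = allFin n} y∈kept) y∈X

  blocking-agree : ∀ X p r → Falsifies r (blockingClause X p) → AgreeOutside X r p
  blocking-agree X p r ¬rC y y∉X = decidable-stable (r y Bool.≟ p y) λ r≢p →
    ¬rC (lose (∈-map⁺ (λ y → lit y (not (p y))) (∈-filter⁺ (λ y → ¬? (y ∈? X)) (∈-allFin y) y∉X))
              (¬-not r≢p))

  -- F splits into its X-clauses and Dis(F, X): a point satisfying the X-clauses and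
  -- agreeing outside X with a model of Dis(F, X) satisfies F.
  splice-model : ∀ {F : CNF n} {X p r} → CNFTrue r (ClausesOf F X) → AgreeOutside X r p →
                 CNFTrue p (Dis F X) → CNFTrue r F
  splice-model {F} {X} {p} {r} Xr r≈p Dp = All.tabulate satisfies
    where
    satisfies : ∀ {C} → C ∈ₗ F → ClauseTrue r C
    satisfies {C} C∈F with isClauseOf? X C
    ... | yes isX = All-filter-lookup (isClauseOf? X) Xr C∈F isX
    ... | no notX = clause-agree C notX (λ v v∉X → sym (r≈p v v∉X))
                      (All-filter-lookup (¬? ∘ isClauseOf? X) Dp C∈F notX)

  unextendable⇒removal-clause : ∀ {F : CNF n} {X p} → ¬ ExistsSem X F p →
                                CNFTrue p (Dis F X) → RemovalClause F X p (blockingClause X p)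
  unextendable⇒removal-clause {F} {X} {p} unext Dp =
    blocking-falsified X p , blocking-avoids X p , implied
    where
    implied : Implies (ClausesOf F X) (blockingClause X p)
    implied r Xr = decidable-stable (clauseTrue? r _) λ ¬rC →
      let r≈p = blocking-agree X p r ¬rC
      in  unext (r , r≈p , splice-model Xr r≈p Dp)

  -- ∃X. F ⇒ ∃(X ∖ X'). Dis(F, X'), for any X': overwrite X' by the target point.
  exists-F⇒exists-Dis : ∀ (F : CNF n) X X' q → ExistsSem X F q → ExistsSem (X ─ X') (Dis F X') q
  exists-F⇒exists-Dis F X X' q (p , p≈q , Fp) = reset , reset≈q , Dreset
    where
    reset : Point n
    reset v with v ∈? X'
    ... | yes _ = q v
    ... | no _ = p v
    reset≈q : AgreeOutside (X ─ X') reset q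
    reset≈q v v∉X─X' with v ∈? X'
    ... | yes _ = refl
    ... | no v∉X' = p≈q v (λ v∈X → v∉X─X' (x∈p∧x∉q⇒x∈p─q v∈X v∉X'))
    p≈reset : AgreeOutside X' p reset
    p≈reset v v∉X' with v ∈? X'
    ... | yes v∈X' = contradiction v∈X' v∉X'
    ... | no _ = refl
    Dreset : CNFTrue reset (Dis F X')
    Dreset = All-filter-tabulate (¬? ∘ isClauseOf? X') λ {C} C∈F notX' →
      clause-agree C notX' p≈reset (All.lookup Fp C∈F)

proposition3 : (n : ℕ) (F : CNF n) (X X' : Subset n) → X' ⊆ X →
    (Equiv (ExistsSem X F) (ExistsSem (X ─ X') (Dis F X')) ⇔ Redundant F X X')
proposition3 n F X X' X'⊆X = mk⇔ equivalence⇒redundant redundant⇒equivalence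
  where
  equivalence⇒redundant : Equiv (ExistsSem X F) (ExistsSem (X ─ X') (Dis F X')) → Redundant F X X'
  equivalence⇒redundant equiv (p , (X'' , X''⊆X' , _ , onlyX'' , _) , _ , _ , removal) =
    let Dp = Equivalence.from (Dis-true⇔ F X' p) (falsified-mono X''⊆X' onlyX'')
        p* , p*≈p , Fp* = Equivalence.from (equiv p) (p , (λ _ _ → refl) , Dp)
    in  extendable⇒no-removal-clause Fp* p*≈p removal

  redundant⇒equivalence : Redundant F X X' → Equiv (ExistsSem X F) (ExistsSem (X ─ X') (Dis F X'))
  redundant⇒equivalence redundant q = mk⇔ (exists-F⇒exists-Dis F X X' q) from-Dis
    where
    from-Dis : ExistsSem (X ─ X') (Dis F X') q → ExistsSem X F q
    from-Dis (p , p≈q , Dp) with existsSem? X F p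
    -- a model agreeing with p outside X also agrees with q there, as X ∖ X' ⊆ X
    ... | yes (r , r≈p , Fr) = r , (λ v v∉X → trans (r≈p v v∉X) (p≈q v (v∉X ∘ p─q⊆p X X'))) , Fr
    ... | no unext
      with boundary-within (λ Fp → unext (p , (λ _ _ → refl) , Fp)) (Equivalence.to (Dis-true⇔ F X' p) Dp)
    ... | within@(Z , Z⊆X' , boundary@(_ , onlyZ , _)) =
      let Z⊆X = ⊆-trans Z⊆X' X'⊆X
          DpX = Equivalence.from (Dis-true⇔ F X p) (falsified-mono Z⊆X onlyZ)
          removal = unextendable⇒removal-clause unext DpX
      in  ⊥-elim (redundant (p , within , (Z , Z⊆X , boundary) , _ , removal))
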